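{- Let $C$ be a non-degenerate $\mathbb{F}_q$-$[n\times m,k]$ rank-metric code and let $\mathcal{M}=\mathcal{M}[C]$. Then \[ \left\lceil\frac{n}{m}\right\rceil\le\operatorname{crit}(\mathcal{M})\le k. \]
   Context: $q$ is a prime power, $n,m\ge2$. An $\mathbb{F}_q$-$[n\times m,k]$ rank-metric code is a $k$-dimensional $\mathbb{F}_q$-subspace $C\subseteq\mathbb{F}_q^{n\times m}$. $\operatorname{supp}(X)$ denotes the column space of $X$; $C$ is non-degenerate if $\sum_{X\in C}\operatorname{supp}(X)=\mathbb{F}_q^n$. $\mathcal{M}[C]$ is the $q$-polymatroid associated with $C$, and for non-degenerate $C$ its critical exponent $\operatorname{crit}(\mathcal{M}[C])$ is the least positive integer $t$ such that there exist $X_1,\ldots,X_t\in C$ with $\sum_{i=1}^t\operatorname{supp}(X_i)=\mathbb{F}_q^n$ (equivalently, the least dimension of a subspace of $C$ whose sum of column spaces is $\mathbb{F}_q^n$). -}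

module Defs where

open import Level using (Level; _⊔_) renaming (suc to lsuc)
open import Algebra.Bundles using (CommutativeRing)
open import Data.Nat as ℕ using (ℕ; zero; suc; _≤_)
open import Data.Nat.DivMod using (_/_)
open import Data.Fin using (Fin; zero; suc)
open import Data.Product using (Σ; ∃; _×_; _,_)
open import Relation.Nullary using (¬_)

-- ⌈ n / m ⌉ (for m ≥ 1); the value at m = 0 is an irrelevant convention.
ceilDiv : ℕ → ℕ → ℕ
ceilDiv n zero    = 0
ceilDiv n (suc m) = (n ℕ.+ m) / suc m

record IsFieldCR {c ℓ : Level} (R : CommutativeRing c ℓ) : Set (c ⊔ ℓ) where
  open CommutativeRing R
  field
    1≉0     : ¬ (1# ≈ 0#)
    inverse : ∀ x → ¬ (x ≈ 0#) → ∃ λ y → (x * y) ≈ 1#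

record FiniteField (c ℓ : Level) : Set (lsuc (c ⊔ ℓ)) where
  field
    commRing : CommutativeRing c ℓ
    isField  : IsFieldCR commRing
  open CommutativeRing commRing public
  field
    q        : ℕ
    enum     : Fin q → Carrier
    enumSurj : ∀ x → ∃ λ i → enum i ≈ x

module _ {c ℓ : Level} (F : FiniteField c ℓ) where
  open FiniteField F using (Carrier; _≈_; _+_; _*_; 0#)

  sumF : (n : ℕ) → (Fin n → Carrier) → Carrier
  sumF zero    f = 0#
  sumF (suc n) f = f zero + sumF n (λ i → f (suc i))

  Vect : ℕ → Set c
  Vect n = Fin n → Carrier

  Mat : ℕ → ℕ → Set c
  Mat n m = Fin n → Fin m → Carrier

  _≈V_ : ∀ {n} → Vect n → Vect n → Set ℓ
  u ≈V v = ∀ i → u i ≈ v i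

  _≈M_ : ∀ {n m} → Mat n m → Mat n m → Set ℓ
  X ≈M Y = ∀ i j → X i j ≈ Y i j

  zeroM : ∀ {n m} → Mat n m
  zeroM i j = 0#

  _+M_ : ∀ {n m} → Mat n m → Mat n m → Mat n m
  (X +M Y) i j = X i j + Y i j

  _·M_ : ∀ {n m} → Carrier → Mat n m → Mat n m
  (a ·M X) i j = a * X i j

  _⊙_ : ∀ {n m} → Mat n m → Vect m → Vect n
  (X ⊙ w) i = sumF _ (λ j → X i j * w j)

  linComb : ∀ {n m} (k : ℕ) → (Fin k → Carrier) → (Fin k → Mat n m) → Mat n m
  linComb k a B i j = sumF k (λ r → a r * B r i j)

  record IsSubspace {p : Level} {n m : ℕ} (C : Mat n m → Set p) : Set (c ⊔ ℓ ⊔ p) where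
    field
      respects : ∀ {X Y} → X ≈M Y → C X → C Y
      zero∈    : C zeroM
      +∈       : ∀ {X Y} → C X → C Y → C (X +M Y)
      ·∈       : ∀ a {X} → C X → C (a ·M X)

  HasDim : ∀ {p} {n m} → (Mat n m → Set p) → ℕ → Set (c ⊔ ℓ ⊔ p)
  HasDim {n = n} {m} C k =
    Σ (Fin k → Mat n m) λ B →
      (∀ r → C (B r))
      × (∀ X → C X → ∃ λ (a : Fin k → Carrier) → X ≈M linComb k a B)
      × (∀ (a : Fin k → Carrier) → linComb k a B ≈M zeroM → ∀ r → a r ≈ 0#)

  record RankMetricCode {p : Level} (n m k : ℕ) (C : Mat n m → Set p) : Set (c ⊔ ℓ ⊔ p) where
    field
      subspace : IsSubspace C
      dim      : HasDim C k

  -- supp(X_1) + … + supp(X_t) = F^n, where supp(X) is the column space of X: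
  -- every v ∈ F^n is Σ_i X_i w_i for some w_i ∈ F^m.
  SuppSumFull : ∀ {n m} (t : ℕ) → (Fin t → Mat n m) → Set (c ⊔ ℓ)
  SuppSumFull {n} {m} t X =
    ∀ (v : Vect n) → ∃ λ (w : Fin t → Vect m) →
      v ≈V (λ i → sumF t (λ r → (X r ⊙ w r) i))

  -- Σ_{X ∈ C} supp(X) = F^n (the sum of subspaces consists of finite sums).
  NonDegenerate : ∀ {p} {n m} → (Mat n m → Set p) → Set (c ⊔ ℓ ⊔ p)
  NonDegenerate {n = n} {m} C =
    ∀ (v : Vect n) → ∃ λ (t : ℕ) → Σ (Fin t → Mat n m) λ X →
      (∀ r → C (X r))
      × ∃ λ (w : Fin t → Vect m) → v ≈V (λ i → sumF t (λ r → (X r ⊙ w r) i))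

  SpanningFamily : ∀ {p} {n m} → (Mat n m → Set p) → ℕ → Set (c ⊔ ℓ ⊔ p)
  SpanningFamily {n = n} {m} C t =
    Σ (Fin t → Mat n m) λ X → (∀ r → C (X r)) × SuppSumFull t X

  -- t = crit(M[C]): the least positive integer t admitting a spanning family of size t.
  IsCrit : ∀ {p} {n m} → (Mat n m → Set p) → ℕ → Set (c ⊔ ℓ ⊔ p)
  IsCrit C t =
    (1 ≤ t) × SpanningFamily C t × (∀ s → 1 ≤ s → SpanningFamily C s → t ≤ s)

{-# OPTIONS --safe #-}
-- Lower bound: if the supports of X₁, …, X_t sum to F^n, then the t·m columns of the Xᵣ span
-- F^n, and a spanning family of F^n has at least n members (Gaussian elimination on the first
-- coordinate), so n ≤ t·m.  Upper bound: every element of C is a combination of a basis, so by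
-- non-degeneracy the supports of the k basis matrices already sum to F^n, and crit is minimal.
module Submission where

open import Defs
open import Level using (Level; _⊔_)
open import Data.Nat using (ℕ; _≤_; zero; suc; z≤n; s≤s; _≤?_)
import Data.Nat as ℕ
open import Data.Nat.Properties using (+-suc; +-comm; +-monoˡ-≤; module ≤-Reasoning)
open import Data.Nat.DivMod using (m<n*o⇒m/o<n)
open import Data.Fin using (Fin; zero; suc; punchIn; _↑ˡ_; _↑ʳ_; combine; remQuot)
open import Data.Fin.Properties using (all?; ¬∀⟶∃¬; sequence; remQuot-combine)
open import Data.Product using (_×_; ∃; _,_; proj₁; proj₂)
open import Data.Empty using (⊥-elim)
open import Effect.Monad using (RawMonad)
open import Function using (_∘_)
open import Relation.Nullary using (¬_; yes; no)
open import Relation.Nullary.Decidable using (¬¬-excluded-middle; decidable-stable)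
open import Relation.Nullary.Negation using (¬¬-Monad; ¬¬-map)
open import Relation.Unary using (Pred; Decidable)
open import Relation.Binary.PropositionalEquality using (cong)

¬¬-decidable : ∀ {p n} (P : Pred (Fin n) p) → ¬ ¬ Decidable P
¬¬-decidable P = sequence (RawMonad.rawApplicative ¬¬-Monad) (λ _ → ¬¬-excluded-middle)

≤*⇒ceilDiv≤ : ∀ {n m} t → n ≤ t ℕ.* suc m → ceilDiv n (suc m) ≤ t
≤*⇒ceilDiv≤ {n} {m} t n≤tm = ℕ.s≤s⁻¹ (m<n*o⇒m/o<n (begin
  suc (n ℕ.+ m)          ≡⟨ +-suc n m ⟨
  n ℕ.+ suc m            ≤⟨ +-monoˡ-≤ (suc m) n≤tm ⟩
  t ℕ.* suc m ℕ.+ suc m  ≡⟨ +-comm (t ℕ.* suc m) (suc m) ⟩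
  suc t ℕ.* suc m        ∎))
  where open ≤-Reasoning

module _ {c ℓ : Level} (F : FiniteField c ℓ) where
  open FiniteField F hiding (zero)
  open IsFieldCR isField
  open import Algebra.Properties.Ring ring using (-‿distribʳ-*)
  open import Algebra.Solver.Ring.NaturalCoefficients.Default commutativeSemiring
  open import Relation.Binary.Reasoning.Setoid setoid

  private
    ∑ : (n : ℕ) → (Fin n → Carrier) → Carrier
    ∑ = sumF F

  ∑-cong : ∀ n {f g : Fin n → Carrier} → (∀ i → f i ≈ g i) → ∑ n f ≈ ∑ n g
  ∑-cong zero    f≈g = refl
  ∑-cong (suc n) f≈g = +-cong (f≈g zero) (∑-cong n (f≈g ∘ suc))

  ∑-zero : ∀ n {f : Fin n → Carrier} → (∀ i → f i ≈ 0#) → ∑ n f ≈ 0#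
  ∑-zero zero    f≈0 = refl
  ∑-zero (suc n) f≈0 = trans (+-cong (f≈0 zero) (∑-zero n (f≈0 ∘ suc))) (+-identityʳ 0#)

  ∑-+ : ∀ n (f g : Fin n → Carrier) → ∑ n (λ i → f i + g i) ≈ ∑ n f + ∑ n g
  ∑-+ zero    f g = sym (+-identityʳ 0#)
  ∑-+ (suc n) f g = begin
    (f zero + g zero) + ∑ n (λ i → f (suc i) + g (suc i))
      ≈⟨ +-congˡ (∑-+ n (f ∘ suc) (g ∘ suc)) ⟩
    (f zero + g zero) + (∑ n (f ∘ suc) + ∑ n (g ∘ suc))
      ≈⟨ solve 4 (λ a b x y → (a :+ b) :+ (x :+ y) := (a :+ x) :+ (b :+ y)) refl _ _ _ _ ⟩
    (f zero + ∑ n (f ∘ suc)) + (g zero + ∑ n (g ∘ suc))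
      ∎

  *-distribˡ-∑ : ∀ n a (f : Fin n → Carrier) → a * ∑ n f ≈ ∑ n (λ i → a * f i)
  *-distribˡ-∑ zero    a f = zeroʳ a
  *-distribˡ-∑ (suc n) a f = trans (distribˡ a _ _) (+-congˡ (*-distribˡ-∑ n a (f ∘ suc)))

  *-distribʳ-∑ : ∀ n a (f : Fin n → Carrier) → ∑ n f * a ≈ ∑ n (λ i → f i * a)
  *-distribʳ-∑ n a f = begin
    ∑ n f * a              ≈⟨ *-comm _ a ⟩
    a * ∑ n f              ≈⟨ *-distribˡ-∑ n a f ⟩
    ∑ n (λ i → a * f i)    ≈⟨ ∑-cong n (λ i → *-comm a (f i)) ⟩
    ∑ n (λ i → f i * a)    ∎

  ∑-comm : ∀ a b (f : Fin a → Fin b → Carrier) →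
           ∑ a (λ x → ∑ b (f x)) ≈ ∑ b (λ y → ∑ a (λ x → f x y))
  ∑-comm zero    b f = sym (∑-zero b (λ _ → refl))
  ∑-comm (suc a) b f = trans (+-congˡ (∑-comm a b (f ∘ suc))) (sym (∑-+ b (f zero) _))

  ∑-punchIn : ∀ n (r : Fin (suc n)) (f : Fin (suc n) → Carrier) →
              ∑ (suc n) f ≈ f r + ∑ n (f ∘ punchIn r)
  ∑-punchIn n       zero    f = refl
  ∑-punchIn (suc n) (suc r) f = begin
    f zero + ∑ (suc n) (f ∘ suc)
      ≈⟨ +-congˡ (∑-punchIn n r (f ∘ suc)) ⟩
    f zero + (f (suc r) + ∑ n (f ∘ suc ∘ punchIn r))
      ≈⟨ solve 3 (λ a b x → a :+ (b :+ x) := b :+ (a :+ x)) refl _ _ _ ⟩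
    f (suc r) + (f zero + ∑ n (f ∘ suc ∘ punchIn r))
      ∎

  ∑-++ : ∀ m n (f : Fin (m ℕ.+ n) → Carrier) →
         ∑ (m ℕ.+ n) f ≈ ∑ m (λ i → f (i ↑ˡ n)) + ∑ n (λ i → f (m ↑ʳ i))
  ∑-++ zero    n f = sym (+-identityˡ _)
  ∑-++ (suc m) n f = trans (+-congˡ (∑-++ m n (f ∘ suc))) (sym (+-assoc _ _ _))

  ∑-combine : ∀ t m (f : Fin (t ℕ.* m) → Carrier) →
              ∑ (t ℕ.* m) f ≈ ∑ t (λ r → ∑ m (λ j → f (combine r j)))
  ∑-combine zero    m f = refl
  ∑-combine (suc t) m f = trans (∑-++ m (t ℕ.* m) f) (+-congˡ (∑-combine t m (f ∘ (m ↑ʳ_))))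

  combination : ∀ {N n} → (Fin N → Carrier) → (Fin N → Vect F n) → Vect F n
  combination {N} a u i = ∑ N (λ s → a s * u s i)

  Spans : ∀ {N} n → (Fin N → Vect F n) → Set (c ⊔ ℓ)
  Spans n u = ∀ (v : Vect F n) → ∃ λ a → _≈V_ F v (combination a u)

  spans-map : ∀ {N a b} {u : Fin N → Vect F a} (L : Vect F a → Vect F b) →
              (∀ {x y} → _≈V_ F x y → _≈V_ F (L x) (L y)) →
              (∀ (e : Fin N → Carrier) → _≈V_ F (L (combination e u)) (combination e (L ∘ u))) →
              (∀ v → ∃ λ x → _≈V_ F v (L x)) →
              Spans a u → Spans b (L ∘ u)
  spans-map L L-cong L-linear L-onto span v =
    let x , v≈Lx = L-onto v
        e , x≈eu = span x
    in e , λ i → trans (v≈Lx i) (trans (L-cong x≈eu i) (L-linear e i))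

  spans-remove : ∀ {N n} (u : Fin (suc N) → Vect F n) r →
                 (∀ i → u r i ≈ 0#) → Spans n u → Spans n (u ∘ punchIn r)
  spans-remove {N} u r ur≈0 span v =
    let e , v≈eu = span v
    in e ∘ punchIn r , λ i → begin
      v i                                             ≈⟨ v≈eu i ⟩
      ∑ (suc N) (λ s → e s * u s i)                   ≈⟨ ∑-punchIn N r (λ s → e s * u s i) ⟩
      e r * u r i + combination (e ∘ punchIn r) (u ∘ punchIn r) i
                                                      ≈⟨ +-congʳ (trans (*-congˡ (ur≈0 i)) (zeroʳ _)) ⟩
      0# + combination (e ∘ punchIn r) (u ∘ punchIn r) i ≈⟨ +-identityˡ _ ⟩
      combination (e ∘ punchIn r) (u ∘ punchIn r) i   ∎

  ¬spans-if-heads-vanish : ∀ {N n} (u : Fin N → Vect F (suc n)) →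
                           (∀ s → u s zero ≈ 0#) → ¬ Spans (suc n) u
  ¬spans-if-heads-vanish {N} u heads≈0 span = 1≉0 (begin
    1#                                ≈⟨ proj₂ (span (λ _ → 1#)) zero ⟩
    combination (proj₁ (span _)) u zero ≈⟨ ∑-zero N (λ s → trans (*-congˡ (heads≈0 s)) (zeroʳ _)) ⟩
    0#                                ∎)

  -- x ↦ tail (x − (x zero · y) · p): for y = (p zero)⁻¹ a linear surjection onto F^n killing p.
  pivotProjection : ∀ {n} → Carrier → Vect F (suc n) → Vect F (suc n) → Vect F n
  pivotProjection y p x i = x (suc i) + x zero * - (y * p (suc i))

  module _ {n} (y : Carrier) (p : Vect F (suc n)) where

    pivotProjection-cong : ∀ {x x′} → _≈V_ F x x′ →
                           _≈V_ F (pivotProjection y p x) (pivotProjection y p x′)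
    pivotProjection-cong x≈x′ i = +-cong (x≈x′ (suc i)) (*-congʳ (x≈x′ zero))

    pivotProjection-linear : ∀ {N} (e : Fin N → Carrier) (u : Fin N → Vect F (suc n)) →
      _≈V_ F (pivotProjection y p (combination e u)) (combination e (pivotProjection y p ∘ u))
    pivotProjection-linear {N} e u i = let κ = - (y * p (suc i)) in begin
      ∑ N (λ s → e s * u s (suc i)) + ∑ N (λ s → e s * u s zero) * κ
        ≈⟨ +-congˡ (*-distribʳ-∑ N κ _) ⟩
      ∑ N (λ s → e s * u s (suc i)) + ∑ N (λ s → e s * u s zero * κ)
        ≈⟨ ∑-+ N _ _ ⟨
      ∑ N (λ s → e s * u s (suc i) + e s * u s zero * κ)
        ≈⟨ ∑-cong N (λ s → solve 4 (λ a x₁ x₀ k → a :* x₁ :+ a :* x₀ :* k := a :* (x₁ :+ x₀ :* k))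
                                   refl (e s) (u s (suc i)) (u s zero) κ) ⟩
      ∑ N (λ s → e s * (u s (suc i) + u s zero * κ)) ∎

    pivotProjection-onto : ∀ v → ∃ λ x → _≈V_ F v (pivotProjection y p x)
    pivotProjection-onto v = x , λ i → sym (trans (+-congˡ (zeroˡ _)) (+-identityʳ (v i)))
      where
      x : Vect F (suc n)
      x zero    = 0#
      x (suc i) = v i

    pivotProjection-pivot : p zero * y ≈ 1# → ∀ i → pivotProjection y p p i ≈ 0#
    pivotProjection-pivot py≈1 i = let w = p (suc i) in begin
      w + p zero * - (y * w)  ≈⟨ +-congˡ (-‿distribʳ-* (p zero) (y * w)) ⟨
      w + - (p zero * (y * w)) ≈⟨ +-congˡ (-‿cong (sym (*-assoc _ _ _))) ⟩
      w + - (p zero * y * w)  ≈⟨ +-congˡ (-‿cong (trans (*-congʳ py≈1) (*-identityˡ w))) ⟩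
      w + - w                 ≈⟨ -‿inverseʳ w ⟩
      0#                      ∎

  spans-eliminate : ∀ {N n} (u : Fin (suc N) → Vect F (suc n)) r → ¬ (u r zero ≈ 0#) →
                    Spans (suc n) u → ∃ λ (u′ : Fin N → Vect F n) → Spans n u′
  spans-eliminate u r ur≉0 span =
    let y , ur·y≈1 = inverse (u r zero) ur≉0
        L = pivotProjection y (u r)
    in L ∘ u ∘ punchIn r ,
       spans-remove (L ∘ u) r (pivotProjection-pivot y (u r) ur·y≈1)
         (spans-map {u = u} L (pivotProjection-cong y (u r)) (λ e → pivotProjection-linear y (u r) e u)
                    (pivotProjection-onto y (u r)) span)

  -- Whether a coordinate vanishes is not decidable, so the pivot search happens under a double
  -- negation, which ℕ's decidable order lets us remove.
  spans⇒dim≤size : ∀ {N} n (u : Fin N → Vect F n) → Spans n u → n ≤ N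
  spans⇒dim≤size         zero    u span = z≤n
  spans⇒dim≤size {zero}  (suc n) u span = ⊥-elim (¬spans-if-heads-vanish u (λ ()) span)
  spans⇒dim≤size {suc N} (suc n) u span =
    decidable-stable (suc n ≤? suc N) (¬¬-map bound (¬¬-decidable (λ s → u s zero ≈ 0#)))
    where
    bound : Decidable (λ s → u s zero ≈ 0#) → suc n ≤ suc N
    bound heads≈0? with all? heads≈0?
    ... | yes heads≈0 = ⊥-elim (¬spans-if-heads-vanish u heads≈0 span)
    ... | no ¬heads≈0 =
      let r , ur≉0 = ¬∀⟶∃¬ (suc N) _ heads≈0? ¬heads≈0
          u′ , span′ = spans-eliminate u r ur≉0 span
      in s≤s (spans⇒dim≤size n u′ span′)

  columns : ∀ {t n m} → (Fin t → Mat F n m) → Fin (t ℕ.* m) → Vect F n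
  columns {m = m} X k i = let r , j = remQuot m k in X r i j

  suppSumFull⇒columns-span : ∀ {t n m} (X : Fin t → Mat F n m) →
                             SuppSumFull F t X → Spans n (columns X)
  suppSumFull⇒columns-span {t} {n} {m} X full v =
    let w , v≈Xw = full v
        a = λ (k : Fin (t ℕ.* m)) → let r , j = remQuot m k in w r j
    in a , λ i → begin
      v i                                                   ≈⟨ v≈Xw i ⟩
      ∑ t (λ r → ∑ m (λ j → X r i j * w r j))              ≈⟨ ∑-cong t (λ r → ∑-cong m (λ j →
                                                               trans (*-comm _ _)
                                                                 (sym (reflexive (cong (λ (r , j) → w r j * X r i j)
                                                                                  (remQuot-combine r j)))))) ⟩
      ∑ t (λ r → ∑ m (λ j → a (combine r j) * columns X (combine r j) i))
                                                            ≈⟨ ∑-combine t m _ ⟨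
      combination a (columns X) i                           ∎

  linComb-⊙ : ∀ {n m} k (e : Fin k → Carrier) (B : Fin k → Mat F n m) (w : Vect F m) →
              _≈V_ F (_⊙_ F (linComb F k e B) w) (λ i → ∑ k (λ s → _⊙_ F (B s) (λ j → e s * w j) i))
  linComb-⊙ {m = m} k e B w i = begin
    ∑ m (λ j → ∑ k (λ s → e s * B s i j) * w j)      ≈⟨ ∑-cong m (λ j → *-distribʳ-∑ k (w j) _) ⟩
    ∑ m (λ j → ∑ k (λ s → e s * B s i j * w j))      ≈⟨ ∑-comm m k _ ⟩
    ∑ k (λ s → ∑ m (λ j → e s * B s i j * w j))      ≈⟨ ∑-cong k (λ s → ∑-cong m (λ j →
                                                          solve 3 (λ a b x → a :* b :* x := b :* (a :* x))
                                                                refl (e s) (B s i j) (w j))) ⟩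
    ∑ k (λ s → ∑ m (λ j → B s i j * (e s * w j)))    ∎

  ∑-⊙ : ∀ {n m} t (M : Mat F n m) (w : Fin t → Vect F m) →
        _≈V_ F (λ i → ∑ t (λ r → _⊙_ F M (w r) i)) (_⊙_ F M (λ j → ∑ t (λ r → w r j)))
  ∑-⊙ {m = m} t M w i = begin
    ∑ t (λ r → ∑ m (λ j → M i j * w r j))   ≈⟨ ∑-comm t m _ ⟩
    ∑ m (λ j → ∑ t (λ r → M i j * w r j))   ≈⟨ ∑-cong m (λ j → *-distribˡ-∑ t (M i j) _) ⟨
    ∑ m (λ j → M i j * ∑ t (λ r → w r j))   ∎

  nonDegenerate⇒generators-suppSumFull :
    ∀ {p n m k} {C : Mat F n m → Set p} (B : Fin k → Mat F n m) →
    (∀ X → C X → ∃ λ e → _≈M_ F X (linComb F k e B)) →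
    NonDegenerate F C → SuppSumFull F k B
  nonDegenerate⇒generators-suppSumFull {m = m} {k} B coordinates nondeg v =
    let t , X , X∈C , w , v≈Xw = nondeg v
        e = λ r → proj₁ (coordinates (X r) (X∈C r))
        X≈eB = λ r → proj₂ (coordinates (X r) (X∈C r))
    in (λ s j → ∑ t (λ r → e r s * w r j)) , λ i → begin
      v i                                                           ≈⟨ v≈Xw i ⟩
      ∑ t (λ r → _⊙_ F (X r) (w r) i)                                ≈⟨ ∑-cong t (λ r →
                                                                         ∑-cong m (λ j → *-congʳ (X≈eB r i j))) ⟩
      ∑ t (λ r → _⊙_ F (linComb F k (e r) B) (w r) i)                ≈⟨ ∑-cong t (λ r → linComb-⊙ k (e r) B (w r) i) ⟩
      ∑ t (λ r → ∑ k (λ s → _⊙_ F (B s) (λ j → e r s * w r j) i))   ≈⟨ ∑-comm t k _ ⟩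
      ∑ k (λ s → ∑ t (λ r → _⊙_ F (B s) (λ j → e r s * w r j) i))   ≈⟨ ∑-cong k (λ s → ∑-⊙ t (B s) _ i) ⟩
      ∑ k (λ s → _⊙_ F (B s) (λ j → ∑ t (λ r → e r s * w r j)) i)   ∎

  suppSumFull⇒nonempty : ∀ {t n m} (X : Fin t → Mat F (suc n) m) → SuppSumFull F t X → 1 ≤ t
  suppSumFull⇒nonempty {zero}  X full = ⊥-elim (1≉0 (proj₂ (full (λ _ → 1#)) zero))
  suppSumFull⇒nonempty {suc t} _ _    = s≤s z≤n

proposition5p1 : ∀ {c ℓ p : Level} (F : FiniteField c ℓ) (n m k : ℕ) →
    2 ≤ n → 2 ≤ m →
    (C : Mat F n m → Set p) → RankMetricCode F n m k C → NonDegenerate F C →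
    ∀ (t : ℕ) → IsCrit F C t → (ceilDiv n m ≤ t) × (t ≤ k)
proposition5p1 F (suc n) (suc m) k _ _ C code nondeg t (_ , (X , _ , X-full) , minimal) =
  let B , B∈C , coordinates , _ = RankMetricCode.dim code
      B-full = nonDegenerate⇒generators-suppSumFull F B coordinates nondeg
  in ≤*⇒ceilDiv≤ t (spans⇒dim≤size F (suc n) (columns F X) (suppSumFull⇒columns-span F X X-full)) ,
     minimal k (suppSumFull⇒nonempty F B B-full) (B , B∈C , B-full)
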